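{- Let $p>3$ be a prime, $t\in \{1,3,p,3p\}$, and $1\leqslant r\leqslant 3p-1$ with $\gcd(r,3p)=1$. Then \[ \mathsf{c}(V_{3p}, a_{3p,r,t})=\begin{cases} \gcd(3p,t) & \text{if } r=1,\\ 3+\frac{3(p-1)}{|r|_p} & \text{if } 1\ne r\equiv 1\pmod 3 \text{ and }t\in\{3,3p\},\\ 1+\frac{p-1}{|r|_p} & \text{if } 1\ne r\equiv 1\pmod 3,\ t\in\{1,p\} \text{ and } 3\nmid |r|_p, \\ 1+\frac{3(p-1)}{|r|_p} & \text{if } 1\ne r\equiv 1\pmod 3,\ t\in\{1,p\} \text{ and } 3\mid |r|_p, \\ 2\gcd(p,t) & \text{if } r\equiv 2\pmod 3 \text{ and } r\equiv 1\pmod p,\\ 2+\frac{2(p-1)}{|r|_p} & \text{if } r\equiv 2\pmod 3,\ r\not\equiv 1\pmod p\text{ and $|r|_p$ is odd}, \\ 2+\frac{3(p-1)}{|r|_p} & \text{if } r\equiv 2\pmod 3,\ r\not\equiv 1\pmod p\text{ and $|r|_p$ is even}. \end{cases} \]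
   Context: $|r|_p$ is the multiplicative order of $r$ modulo $p$. $\mathrm{D}_{6p}=\langle u_{3p},v_{3p}\mid u_{3p}^{3p}=v_{3p}^2=1,\ v_{3p}u_{3p}v_{3p}=u_{3p}^{ -1}\rangle$; $a_{3p,r,t}$ is the automorphism $u_{3p}^i\mapsto u_{3p}^{ri}$, $u_{3p}^jv_{3p}\mapsto u_{3p}^{rj+t}v_{3p}$. $V_{3p}=\{u_{3p}^iv_{3p}\mid 0\le i\le 3p-1\}$. $\mathsf{c}(V_{3p},a)$ is the number of cycles (including fixed points) of the permutation induced by $a$ on $V_{3p}$. -}

module Defs where

open import Data.Nat using (ℕ; zero; suc; _+_; _*_; _∸_; _^_; _≤_; _<_; _≤ᵇ_; NonZero)
open import Data.Nat.DivMod using (_%_)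
open import Data.Bool using (Bool; true; false)
open import Data.Product using (_×_; _,_; proj₁)
open import Data.List using (List; length; filterᵇ; upTo)
open import Data.Bool using (_∧_)
open import Data.List using (_∷_; [])
open import Data.Nat.Properties using (m*n≢0)
open import Relation.Binary.PropositionalEquality using (_≡_)

-- Elements of the dihedral group D_{2n} = ⟨u,v | u^n = v^2 = 1, vuv = u^{-1}⟩
-- written in normal form: (i , false) ↦ u^i  and  (i , true) ↦ u^i v,  0 ≤ i < n.
Dih : Set
Dih = ℕ × Bool

-- The automorphism a_{n,r,t}: u^i ↦ u^{ri},  u^j v ↦ u^{rj+t} v  (exponents mod n).
aut : (n : ℕ) .{{_ : NonZero n}} → ℕ → ℕ → Dih → Dih
aut n r t (i , false) = (r * i) % n , false
aut n r t (j , true)  = (r * j + t) % n , true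

-- The permutation induced by a_{n,r,t} on V_n = {u^j v | 0 ≤ j < n},
-- with u^j v identified with its index j.
autV : (n : ℕ) .{{_ : NonZero n}} → ℕ → ℕ → ℕ → ℕ
autV n r t j = proj₁ (aut n r t (j , true))

iter : (ℕ → ℕ) → ℕ → ℕ → ℕ
iter f zero    x = x
iter f (suc k) x = f (iter f k x)

allᵇ : (ℕ → Bool) → List ℕ → Bool
allᵇ P [] = true
allᵇ P (x ∷ xs) = P x ∧ allᵇ P xs

-- Number of cycles (fixed points included) of a permutation f of {0,…,n-1}:
-- each cycle is counted once, via its least element, i.e. the number of j < n
-- with j ≤ f^k(j) for all k < n (every cycle has length ≤ n).
cycles : ℕ → (ℕ → ℕ) → ℕ
cycles n f = length (filterᵇ (λ j → allᵇ (λ k → j ≤ᵇ iter f k j) (upTo n)) (upTo n))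

cV : (n : ℕ) .{{_ : NonZero n}} → ℕ → ℕ → ℕ
cV n r t = cycles n (autV n r t)

IsMultOrder : (p : ℕ) .{{_ : NonZero p}} → ℕ → ℕ → Set
IsMultOrder p r k = 1 ≤ k × (r ^ k) % p ≡ 1 % p × (∀ m → 1 ≤ m → (r ^ m) % p ≡ 1 % p → k ≤ m)

cV3p : (p : ℕ) .{{_ : NonZero p}} → ℕ → ℕ → ℕ
cV3p p r t = cV (3 * p) {{m*n≢0 3 p}} r t

{-# OPTIONS --safe #-}
-- By the Chinese remainder theorem, j ↦ (j mod 3, j mod p) turns the map j ↦ r j + t on ℤ/3p into
-- the pair of affine maps y ↦ r y + t on ℤ/3 and on ℤ/p, so the period of j under a_{3p,r,t} is the
-- lcm of the periods of its two residues.  Modulo a prime q, if r ≡ 1 the affine map is a translation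
-- and every point has period 1 (q ∣ t) or q (q ∤ t); otherwise it has a unique fixed point and every
-- other point has period |r|_q.  For a permutation whose periods all divide L, every cycle of length ℓ
-- consists of ℓ points of weight L / ℓ, so L · (number of cycles) = Σ_j L / period(j).  Sorting j by
-- whether its residues are the distinguished points gives classes of sizes 1, p - 1, 2 and 2 (p - 1),
-- and each case of the theorem is this sum evaluated.  The hypothesis gcd(r, 3p) = 1 is never used:
-- in every case it follows from the hypothesis on r mod 3 and the existence of |r|_p.
module Submission where

open import Defs
open import Data.Nat using (ℕ; _+_; _*_; _∸_; _≤_; _<_; NonZero)
open import Data.Nat.DivMod using (_%_; _/_)
open import Data.Nat.Divisibility using (_∣_)
open import Data.Nat.GCD using (gcd)
open import Data.Nat.Primality using (Prime)
open import Data.Product using (_×_)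
open import Data.Sum using (_⊎_)
open import Relation.Binary.PropositionalEquality using (_≡_)
open import Relation.Nullary using (¬_)

open import Data.Bool using (Bool; true; false; T; if_then_else_)
open import Data.Bool.Properties using (T-∧; T-≡; ¬-not)
open import Data.Empty using (⊥-elim)
open import Data.List using ([]; _∷_; _++_; length; filterᵇ; upTo)
open import Data.List.Extrema.Nat using (argmin; f[argmin]≤f[xs])
open import Data.List.Membership.Propositional.Properties using (∈-upTo⁺; ∈-upTo⁻)
open import Data.List.Properties using (upTo-∷ʳ; length-++; filter-++)
open import Data.List.Relation.Unary.All as All using (All)
open import Data.Nat
  using (zero; suc; z<s; _^_; _≡ᵇ_; _≤ᵇ_; z≤n; s≤s; s≤s⁻¹; _≟_; >-nonZero; >-nonZero⁻¹; ≢-nonZero; ≢-nonZero⁻¹)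
open import Data.Nat.Coprimality using (Coprime; coprime-Bézout; coprime-divisor; coprime⇒gcd≡1)
open import Data.Nat.Divisibility
  using ( _∣?_; divides; ∣-refl; ∣-antisym; ∣-trans; ∣⇒≤; 1∣_; n∣m*n; m∣m*n; ∣n⇒∣m*n; ∣m⇒∣m*n
        ; *-monoˡ-∣; m%n≡0⇒n∣m; n∣m⇒m%n≡0)
open import Data.Nat.DivMod
  using ( m≡m%n+[m/n]*n; m%n<n; m%n%n≡m%n; m<n⇒m%n≡m; m∣n⇒o%n%m≡o%m; m*n/n≡m
        ; %-distribˡ-+; %-distribˡ-*; %-remove-+ʳ)
open import Data.Nat.GCD using (module Bézout; gcd[m,n]∣m; gcd[m,n]∣n; gcd-greatest; gcd-zeroʳ)
open import Data.Nat.LCM using (lcm; lcm-least; m∣lcm[m,n]; n∣lcm[m,n]; gcd*lcm)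
open import Data.Nat.Primality using (prime⇒irreducible; euclidsLemma; prime?; prime[2])
open import Data.Nat.Properties
open import Data.Nat.Tactic.RingSolver using (solve-∀)
open import Data.Product using (∃; _,_; proj₁; proj₂)
open import Data.Sum using (inj₁; inj₂; [_,_]′)
open import Function using (id; _∘_; flip; _⇔_; mk⇔; Equivalence)
open import Function.Construct.Composition using (_⇔-∘_)
open import Level using (0ℓ)
open import Relation.Binary.Bundles using (Setoid)
open import Relation.Binary.Definitions using (tri<; tri≈; tri>)
open import Relation.Binary.PropositionalEquality
  using (_≢_; refl; sym; trans; cong; cong₂; subst; module ≡-Reasoning)
import Relation.Binary.Reasoning.Setoid as SetoidReasoning
open import Relation.Nullary using (yes; no)
open import Relation.Nullary.Decidable using (T?; from-yes)

open import Algebra.Properties.CommutativeSemigroup +-commutativeSemigroup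
  using () renaming (interchange to +-interchange)

open Equivalence using (to; from)

∑ : ℕ → (ℕ → ℕ) → ℕ
∑ zero    f = 0
∑ (suc n) f = ∑ n f + f n

∑-cong : ∀ n {f g : ℕ → ℕ} → (∀ {i} → i < n → f i ≡ g i) → ∑ n f ≡ ∑ n g
∑-cong zero    f≡g = refl
∑-cong (suc n) f≡g = cong₂ _+_ (∑-cong n (f≡g ∘ m<n⇒m<1+n)) (f≡g (n<1+n n))

∑-const : ∀ n c → ∑ n (λ _ → c) ≡ n * c
∑-const zero    c = refl
∑-const (suc n) c = trans (cong (_+ c) (∑-const n c)) (+-comm (n * c) c)

∑-mono-≤ : ∀ n {f g : ℕ → ℕ} → (∀ {i} → i < n → f i ≤ g i) → ∑ n f ≤ ∑ n g
∑-mono-≤ zero    f≤g = z≤n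
∑-mono-≤ (suc n) f≤g = +-mono-≤ (∑-mono-≤ n (f≤g ∘ m<n⇒m<1+n)) (f≤g (n<1+n n))

∑-distrib-+ : ∀ n (f g : ℕ → ℕ) → ∑ n (λ i → f i + g i) ≡ ∑ n f + ∑ n g
∑-distrib-+ zero    f g = refl
∑-distrib-+ (suc n) f g = trans (cong (_+ (f n + g n)) (∑-distrib-+ n f g))
  (+-interchange (∑ n f) (∑ n g) (f n) (g n))

*-distribˡ-∑ : ∀ n c (f : ℕ → ℕ) → c * ∑ n f ≡ ∑ n (λ i → c * f i)
*-distribˡ-∑ zero    c f = *-zeroʳ c
*-distribˡ-∑ (suc n) c f = trans (*-distribˡ-+ c (∑ n f) (f n)) (cong (_+ c * f n) (*-distribˡ-∑ n c f))

*-distribʳ-∑ : ∀ n c (f : ℕ → ℕ) → ∑ n f * c ≡ ∑ n (λ i → f i * c)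
*-distribʳ-∑ n c f = trans (*-comm (∑ n f) c)
  (trans (*-distribˡ-∑ n c f) (∑-cong n (λ {i} _ → *-comm c (f i))))

∑-swap : ∀ m n (F : ℕ → ℕ → ℕ) → ∑ m (λ i → ∑ n (F i)) ≡ ∑ n (λ j → ∑ m (λ i → F i j))
∑-swap zero    n F = sym (trans (∑-const n 0) (*-zeroʳ n))
∑-swap (suc m) n F = trans (cong (_+ ∑ n (F m)) (∑-swap m n F))
  (sym (∑-distrib-+ n (λ j → ∑ m (λ i → F i j)) (F m)))

∑-swap₃ : ∀ n m q (F : ℕ → ℕ → ℕ → ℕ) →
          ∑ n (λ j → ∑ m (λ x → ∑ q (F j x))) ≡ ∑ m (λ x → ∑ q (λ y → ∑ n (λ j → F j x y)))
∑-swap₃ n m q F = trans (∑-swap n m _) (∑-cong m (λ {x} _ → ∑-swap n q (λ j → F j x)))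

∑-positive : ∀ n (f : ℕ → ℕ) → 0 < ∑ n f → ∃ λ i → i < n × 0 < f i
∑-positive (suc n) f pos with f n in fn≡
... | suc _ = n , n<1+n n , subst (0 <_) (sym fn≡) (s≤s z≤n)
... | zero with ∑-positive n f (subst (0 <_) (+-identityʳ (∑ n f)) pos)
...   | i , i<n , fi>0 = i , m<n⇒m<1+n i<n , fi>0

+-tight : ∀ {a b c d} → a ≤ c → b ≤ d → a + b ≡ c + d → a ≡ c × b ≡ d
+-tight {a} {b} {c} {d} a≤c b≤d sum≡ = a≡c , +-cancelˡ-≡ a b d (trans sum≡ (cong (_+ d) (sym a≡c)))
  where
  a≡c = ≤-antisym a≤c (+-cancelʳ-≤ d c a (≤-trans (≤-reflexive (sym sum≡)) (+-monoʳ-≤ a b≤d)))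

∑-tight : ∀ n (f : ℕ → ℕ) b → (∀ {i} → i < n → f i ≤ b) → ∑ n f ≡ n * b → ∀ {i} → i < n → f i ≡ b
∑-tight (suc n) f b f≤b ∑≡ {i} i<1+n = case (m≤n⇒m<n∨m≡n (s≤s⁻¹ i<1+n))
  where
  f<n≤b : ∀ {i} → i < n → f i ≤ b
  f<n≤b = f≤b ∘ m<n⇒m<1+n
  parts : ∑ n f ≡ n * b × f n ≡ b
  parts = +-tight (≤-trans (∑-mono-≤ n f<n≤b) (≤-reflexive (∑-const n b))) (f≤b (n<1+n n))
    (trans ∑≡ (+-comm b (n * b)))
  case : i < n ⊎ i ≡ n → f i ≡ b
  case (inj₁ i<n) = ∑-tight n f b f<n≤b (proj₁ parts) i<n
  case (inj₂ refl) = proj₂ parts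

χ : Bool → ℕ
χ true  = 1
χ false = 0

χ-T : ∀ {b} → T b → χ b ≡ 1
χ-T {true} _ = refl

χ-¬T : ∀ {b} → ¬ T b → χ b ≡ 0
χ-¬T {true}  ¬T = ⊥-elim (¬T _)
χ-¬T {false} _  = refl

δ : ℕ → ℕ → ℕ
δ x y with x ≟ y
... | yes _ = 1
... | no  _ = 0

δ-refl : ∀ x → δ x x ≡ 1
δ-refl x with x ≟ x
... | yes _   = refl
... | no  x≢x = ⊥-elim (x≢x refl)

δ-≢ : ∀ {x y} → x ≢ y → δ x y ≡ 0
δ-≢ {x} {y} x≢y with x ≟ y
... | yes x≡y = ⊥-elim (x≢y x≡y)
... | no  _   = refl

δ*δ>0 : ∀ {a x b y} → 0 < δ a x * δ b y → a ≡ x × b ≡ y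
δ*δ>0 {a} {x} {b} {y} pos with a ≟ x | b ≟ y
... | yes a≡x | yes b≡y = a≡x , b≡y
δ*δ>0 () | yes _ | no _
δ*δ>0 () | no _  | _

δ-comm : ∀ x y → δ x y ≡ δ y x
δ-comm x y with x ≟ y | y ≟ x
... | yes _   | yes _   = refl
... | no  _   | no  _   = refl
... | yes x≡y | no  y≢x = ⊥-elim (y≢x (sym x≡y))
... | no  x≢y | yes y≡x = ⊥-elim (x≢y (sym y≡x))

δ>0⇒≡ : ∀ {x y} → 0 < δ x y → x ≡ y
δ>0⇒≡ {x} {y} pos with x ≟ y
... | yes x≡y = x≡y
δ>0⇒≡ {x} {y} () | no _

∑-δ-beyond : ∀ n {x} (h : ℕ → ℕ) → n ≤ x → ∑ n (λ i → δ x i * h i) ≡ 0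
∑-δ-beyond zero    h n≤x = refl
∑-δ-beyond (suc n) {x} h n<x = cong₂ (λ a b → a + b * h n) (∑-δ-beyond n h (<⇒≤ n<x)) (δ-≢ (>⇒≢ n<x))

∑-δ : ∀ n {x} (h : ℕ → ℕ) → x < n → ∑ n (λ i → δ x i * h i) ≡ h x
∑-δ (suc n) {x} h x<1+n with x ≟ n
... | yes refl = trans (cong (_+ (h x + 0)) (∑-δ-beyond x h ≤-refl)) (+-identityʳ (h x))
... | no  x≢n  = trans (cong (_+ 0) (∑-δ n h (≤∧≢⇒< (s≤s⁻¹ x<1+n) x≢n))) (+-identityʳ (h x))

∑-δ₁ : ∀ n {x} → x < n → ∑ n (δ x) ≡ 1
∑-δ₁ n {x} x<n = trans (∑-cong n (λ {i} _ → sym (*-identityʳ (δ x i)))) (∑-δ n (λ _ → 1) x<n)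

≡ᵇ-refl : ∀ n → (n ≡ᵇ n) ≡ true
≡ᵇ-refl n = to T-≡ (≡⇒≡ᵇ n n refl)

≢⇒≡ᵇ≡false : ∀ {m n} → m ≢ n → (m ≡ᵇ n) ≡ false
≢⇒≡ᵇ≡false {m} {n} m≢n = ¬-not (λ eq → m≢n (≡ᵇ⇒≡ m n (from T-≡ eq)))

∑-≡ᵇ : ∀ n {c} (H : Bool → ℕ) → c < n → ∑ n (λ i → H (i ≡ᵇ c)) ≡ H true + (n ∸ 1) * H false
∑-≡ᵇ (suc n) {c} H c<1+n with m≤n⇒m<n∨m≡n (s≤s⁻¹ c<1+n)
... | inj₂ refl = begin
  ∑ c (λ i → H (i ≡ᵇ c)) + H (c ≡ᵇ c)
    ≡⟨ cong₂ _+_ (∑-cong c (λ i<c → cong H (≢⇒≡ᵇ≡false (<⇒≢ i<c)))) (cong H (≡ᵇ-refl c)) ⟩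
  ∑ c (λ _ → H false) + H true        ≡⟨ cong (_+ H true) (∑-const c (H false)) ⟩
  c * H false + H true                ≡⟨ +-comm (c * H false) (H true) ⟩
  H true + c * H false                ∎
  where open ≡-Reasoning
∑-≡ᵇ (suc (suc n′)) {c} H _ | inj₁ c<n = begin
  ∑ (suc n′) (λ i → H (i ≡ᵇ c)) + H (suc n′ ≡ᵇ c)
    ≡⟨ cong₂ _+_ (∑-≡ᵇ (suc n′) H c<n) (cong H (≢⇒≡ᵇ≡false (>⇒≢ c<n))) ⟩
  H true + n′ * H false + H false                 ≡⟨ +-assoc (H true) (n′ * H false) (H false) ⟩
  H true + (n′ * H false + H false)               ≡⟨ cong (H true +_) (+-comm (n′ * H false) (H false)) ⟩
  H true + suc n′ * H false                       ∎
  where open ≡-Reasoning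

length-filterᵇ-upTo : ∀ (P : ℕ → Bool) n → length (filterᵇ P (upTo n)) ≡ ∑ n (χ ∘ P)
length-filterᵇ-upTo P zero    = refl
length-filterᵇ-upTo P (suc n) = begin
  length (filterᵇ P (upTo (suc n)))                         ≡⟨ cong (length ∘ filterᵇ P) (upTo-∷ʳ n) ⟨
  length (filterᵇ P (upTo n ++ n ∷ []))                     ≡⟨ cong length (filter-++ (T? ∘ P) (upTo n) (n ∷ [])) ⟩
  length (filterᵇ P (upTo n) ++ filterᵇ P (n ∷ []))         ≡⟨ length-++ (filterᵇ P (upTo n)) ⟩
  length (filterᵇ P (upTo n)) + length (filterᵇ P (n ∷ [])) ≡⟨ cong₂ _+_ (length-filterᵇ-upTo P n) singleton ⟩
  ∑ n (χ ∘ P) + χ (P n)                                     ∎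
  where
  open ≡-Reasoning
  singleton : length (filterᵇ P (n ∷ [])) ≡ χ (P n)
  singleton with P n
  ... | true  = refl
  ... | false = refl

T-allᵇ : ∀ (P : ℕ → Bool) xs → T (allᵇ P xs) ⇔ All (T ∘ P) xs
T-allᵇ P []       = mk⇔ (λ _ → All.[]) (λ _ → _)
T-allᵇ P (x ∷ xs) = mk⇔
  (λ Pxs → let (Px , Pxs′) = to T-∧ Pxs in Px All.∷ to (T-allᵇ P xs) Pxs′)
  (λ { (Px All.∷ Pxs) → from T-∧ (Px , from (T-allᵇ P xs) Pxs) })

T-allᵇ-upTo : ∀ (P : ℕ → Bool) n → T (allᵇ P (upTo n)) ⇔ (∀ {k} → k < n → T (P k))
T-allᵇ-upTo P n = mk⇔
  (λ all {k} k<n → All.lookup (to (T-allᵇ P (upTo n)) all) (∈-upTo⁺ k<n))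
  (λ P<n → from (T-allᵇ P (upTo n)) (All.tabulate (P<n ∘ ∈-upTo⁻)))

Periods : ℕ → (ℕ → ℕ) → (ℕ → ℕ) → Set
Periods n f per = ∀ {j} m → j < n → iter f m j ≡ j ⇔ per j ∣ m

record TwoPeriods (q : ℕ) (g : ℕ → ℕ) : Set where
  field
    centre   : ℕ
    centre<q : centre < q
    period   : Bool → ℕ
    periods  : Periods q g (λ y → period (y ≡ᵇ centre))

uniformPeriods : ∀ {q g} a → 0 < q → Periods q g (λ _ → a) → TwoPeriods q g
uniformPeriods a 0<q periods = record { centre = 0 ; centre<q = 0<q ; period = λ _ → a ; periods = periods }

iter-+ : ∀ (f : ℕ → ℕ) a b x → iter f (a + b) x ≡ iter f a (iter f b x)
iter-+ f zero    b x = refl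
iter-+ f (suc a) b x = cong f (iter-+ f a b x)

iter-comm : ∀ (f : ℕ → ℕ) a b x → iter f a (iter f b x) ≡ iter f b (iter f a x)
iter-comm f a b x = begin
  iter f a (iter f b x) ≡⟨ iter-+ f a b x ⟨
  iter f (a + b) x      ≡⟨ cong (λ c → iter f c x) (+-comm a b) ⟩
  iter f (b + a) x      ≡⟨ iter-+ f b a x ⟩
  iter f b (iter f a x) ∎
  where open ≡-Reasoning

iter-closed : ∀ {n f} → (∀ {j} → j < n → f j < n) → ∀ a {j} → j < n → iter f a j < n
iter-closed f<n zero    j<n = j<n
iter-closed f<n (suc a) j<n = f<n (iter-closed f<n a j<n)

iter-% : ∀ {d} .{{_ : NonZero d}} {f g : ℕ → ℕ} → (∀ j → f j % d ≡ g (j % d)) →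
         ∀ a j → iter f a j % d ≡ iter g a (j % d)
iter-% f%≡ zero    j = refl
iter-% {g = g} f%≡ (suc a) j = trans (f%≡ _) (cong g (iter-% f%≡ a j))

iter-fixed-along : ∀ (f : ℕ → ℕ) a m {x y} → iter f a x ≡ y → iter f m x ≡ x → iter f m y ≡ y
iter-fixed-along f a m {x} refl fixed = trans (iter-comm f m a x) (cong (iter f a) fixed)

δ-injective : ∀ (g : ℕ → ℕ) {a b} → (g a ≡ g b → a ≡ b) → δ (g a) (g b) ≡ δ a b
δ-injective g {a} {b} inj with a ≟ b
... | yes refl = δ-refl (g a)
... | no  a≢b  = δ-≢ (a≢b ∘ inj)

module CycleCount {n : ℕ} {f : ℕ → ℕ} (f<n : ∀ {j} → j < n → f j < n)
              {per : ℕ → ℕ} (periods : Periods n f per)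
              (per≢0 : ∀ {j} → j < n → NonZero (per j)) where

  iter-< : ∀ a {j} → j < n → iter f a j < n
  iter-< = iter-closed f<n

  iter-per : ∀ {j} c → j < n → iter f (c * per j) j ≡ j
  iter-per c j<n = from (periods _ j<n) (n∣m*n c)

  iter-%per : ∀ {j} a → (j<n : j < n) → iter f a j ≡ iter f (_%_ a (per j) {{per≢0 j<n}}) j
  iter-%per {j} a j<n = begin
    iter f a j                         ≡⟨ cong (λ b → iter f b j) (m≡m%n+[m/n]*n a (per j)) ⟩
    iter f (a % per j + c * per j) j   ≡⟨ iter-+ f (a % per j) (c * per j) j ⟩
    iter f (a % per j) (iter f (c * per j) j) ≡⟨ cong (iter f (a % per j)) (iter-per c j<n) ⟩
    iter f (a % per j) j               ∎
    where
    open ≡-Reasoning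
    instance
      per≢0ⱼ : NonZero (per j)
      per≢0ⱼ = per≢0 j<n
    c = a / per j

  iter-return : ∀ {j} a → j < n → iter f (a * (per j ∸ 1)) (iter f a j) ≡ j
  iter-return {j} a j<n = begin
    iter f (a * (per j ∸ 1)) (iter f a j) ≡⟨ iter-+ f (a * (per j ∸ 1)) a j ⟨
    iter f (a * (per j ∸ 1) + a) j        ≡⟨ cong (λ b → iter f b j) a*per ⟩
    iter f (a * per j) j                  ≡⟨ iter-per a j<n ⟩
    j                                     ∎
    where
    open ≡-Reasoning
    instance
      per≢0ⱼ : NonZero (per j)
      per≢0ⱼ = per≢0 j<n
    a*per : a * (per j ∸ 1) + a ≡ a * per j
    a*per = trans (+-comm _ a) (trans (sym (*-suc a (per j ∸ 1))) (cong (a *_) (suc-pred (per j))))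

  per-iter : ∀ {j} a → j < n → per (iter f a j) ≡ per j
  per-iter {j} a j<n = ∣-antisym
    (to (periods (per j) y<n) (iter-fixed-along f a (per j) refl (from (periods (per j) j<n) ∣-refl)))
    (to (periods (per y) j<n)
        (iter-fixed-along f (a * (per j ∸ 1)) (per y) (iter-return a j<n) (from (periods _ y<n) ∣-refl)))
    where
    y = iter f a j
    y<n = iter-< a j<n

  iter-≢ : ∀ {j a b} → j < n → a < b → b < per j → iter f a j ≢ iter f b j
  iter-≢ {j} {a} {b} j<n a<b b<per eq = <⇒≱ (≤-<-trans (m∸n≤m b a) b<per) per≤b∸a
    where
    back : iter f (b ∸ a) (iter f a j) ≡ iter f a j
    back = trans (sym (iter-+ f (b ∸ a) a j)) (trans (cong (λ c → iter f c j) (m∸n+n≡m (<⇒≤ a<b))) (sym eq))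
    per≤b∸a : per j ≤ b ∸ a
    per≤b∸a = subst (_≤ b ∸ a) (per-iter a j<n)
      (∣⇒≤ {{>-nonZero (m<n⇒0<n∸m a<b)}} (to (periods _ (iter-< a j<n)) back))

  iter-injective : ∀ {j a b} → j < n → a < per j → b < per j → iter f a j ≡ iter f b j → a ≡ b
  iter-injective {j} {a} {b} j<n a<per b<per eq with <-cmp a b
  ... | tri≈ _ a≡b _ = a≡b
  ... | tri< a<b _ _ = ⊥-elim (iter-≢ j<n a<b b<per eq)
  ... | tri> _ _ b<a = ⊥-elim (iter-≢ j<n b<a a<per (sym eq))

  _↝_ : ℕ → ℕ → Set
  j ↝ i = ∃ λ a → iter f a j ≡ i

  inOrbit : ℕ → ℕ → ℕ
  inOrbit j i = ∑ (per j) (λ a → δ (iter f a j) i)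

  ∑-inOrbit : ∀ {j} (w : ℕ → ℕ) → j < n →
              ∑ n (λ i → inOrbit j i * w i) ≡ ∑ (per j) (λ a → w (iter f a j))
  ∑-inOrbit {j} w j<n = begin
    ∑ n (λ i → inOrbit j i * w i)
      ≡⟨ ∑-cong n (λ {i} _ → *-distribʳ-∑ (per j) (w i) _) ⟩
    ∑ n (λ i → ∑ (per j) (λ a → δ (iter f a j) i * w i))
      ≡⟨ ∑-swap n (per j) _ ⟩
    ∑ (per j) (λ a → ∑ n (λ i → δ (iter f a j) i * w i))
      ≡⟨ ∑-cong (per j) (λ {a} _ → ∑-δ n w (iter-< a j<n)) ⟩
    ∑ (per j) (λ a → w (iter f a j)) ∎
    where open ≡-Reasoning

  inOrbit-iter : ∀ {j} a → j < n → inOrbit j (iter f a j) ≡ 1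
  inOrbit-iter {j} a j<n = begin
    ∑ (per j) (λ b → δ (iter f b j) (iter f a j))
      ≡⟨ cong (λ y → ∑ (per j) (λ b → δ (iter f b j) y)) (iter-%per a j<n) ⟩
    ∑ (per j) (λ b → δ (iter f b j) (iter f a′ j))
      ≡⟨ ∑-cong (per j) (λ b<per → δ-injective (λ b → iter f b j) (iter-injective j<n b<per a′<per)) ⟩
    ∑ (per j) (λ b → δ b a′)
      ≡⟨ ∑-cong (per j) (λ {b} _ → δ-comm b a′) ⟩
    ∑ (per j) (δ a′)
      ≡⟨ ∑-δ₁ (per j) a′<per ⟩
    1 ∎
    where
    open ≡-Reasoning
    instance
      per≢0ⱼ : NonZero (per j)
      per≢0ⱼ = per≢0 j<n
    a′ = a % per j
    a′<per = m%n<n a (per j)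

  inOrbit-cases : ∀ {j} i → j < n → inOrbit j i ≡ 0 ⊎ j ↝ i
  inOrbit-cases {j} i j<n with inOrbit j i in eq
  ... | zero  = inj₁ refl
  ... | suc _ with ∑-positive (per j) _ (subst (0 <_) (sym eq) (s≤s z≤n))
  ...   | a , _ , pos = inj₂ (a , δ>0⇒≡ pos)

  inOrbit≤1 : ∀ {j} i → j < n → inOrbit j i ≤ 1
  inOrbit≤1 i j<n with inOrbit-cases i j<n
  ... | inj₁ eq = subst (_≤ 1) (sym eq) z≤n
  ... | inj₂ (a , refl) = ≤-reflexive (inOrbit-iter a j<n)

  per≤n : ∀ {j} → j < n → per j ≤ n
  per≤n {j} j<n = begin
    per j                           ≡⟨ *-identityʳ (per j) ⟨
    per j * 1                       ≡⟨ ∑-const (per j) 1 ⟨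
    ∑ (per j) (λ _ → 1)             ≡⟨ ∑-inOrbit (λ _ → 1) j<n ⟨
    ∑ n (λ i → inOrbit j i * 1)     ≤⟨ ∑-mono-≤ n (λ {i} _ → *-monoˡ-≤ 1 (inOrbit≤1 i j<n)) ⟩
    ∑ n (λ _ → 1 * 1)               ≡⟨ ∑-const n 1 ⟩
    n * 1                           ≡⟨ *-identityʳ n ⟩
    n                               ∎
    where open ≤-Reasoning

  IsLeast : ℕ → Set
  IsLeast j = ∀ k → j ≤ iter f k j

  least? : ℕ → Bool
  least? j = allᵇ (λ k → j ≤ᵇ iter f k j) (upTo n)

  T-least? : ∀ {j} → j < n → T (least? j) ⇔ IsLeast j
  T-least? {j} j<n = mk⇔
    (λ t k → subst (j ≤_) (sym (iter-%per k j<n))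
       (≤ᵇ⇒≤ j _ (to (T-allᵇ-upTo _ n) t (<-≤-trans (m%n<n k (per j)) (per≤n j<n)))))
    (λ least → from (T-allᵇ-upTo _ n) (λ {k} _ → ≤⇒≤ᵇ (least k)))
    where
    instance
      per≢0ⱼ : NonZero (per j)
      per≢0ⱼ = per≢0 j<n

  least-in-orbit : ∀ {i} → i < n → ∃ λ j → j < n × IsLeast j × j ↝ i
  least-in-orbit {i} i<n = j , iter-< c i<n , least , c * (per i ∸ 1) , iter-return c i<n
    where
    instance
      per≢0ᵢ : NonZero (per i)
      per≢0ᵢ = per≢0 i<n
    c = argmin (λ a → iter f a i) 0 (upTo (per i))
    j = iter f c i
    below : ∀ a → j ≤ iter f a i
    below a = subst (j ≤_) (sym (iter-%per a i<n))
      (All.lookup (f[argmin]≤f[xs] {f = λ a → iter f a i} 0 (upTo (per i))) (∈-upTo⁺ (m%n<n a (per i))))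
    least : IsLeast j
    least k = subst (j ≤_) (iter-+ f k c i) (below (k + c))

  least-unique : ∀ {j j′ i} → j′ < n → IsLeast j → j ↝ i → j′ ↝ i → j ≤ j′
  least-unique {j} {j′} j′<n least (a , refl) (b , i≡) = subst (j ≤_) j′≡ (least (c + a))
    where
    c = b * (per j′ ∸ 1)
    j′≡ : iter f (c + a) j ≡ j′
    j′≡ = trans (iter-+ f c a j) (trans (cong (iter f c) (sym i≡)) (iter-return b j′<n))

  ∑-least-inOrbit : ∀ {i} → i < n → ∑ n (λ j → χ (least? j) * inOrbit j i) ≡ 1
  ∑-least-inOrbit {i} i<n with least-in-orbit i<n
  ... | j₀ , j₀<n , least₀ , j₀↝i@(a₀ , i≡) = trans (∑-cong n term) (∑-δ₁ n j₀<n)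
    where
    term : ∀ {j} → j < n → χ (least? j) * inOrbit j i ≡ δ j₀ j
    term {j} j<n with j₀ ≟ j
    ... | yes refl = cong₂ _*_ (χ-T {least? j} (from (T-least? j<n) least₀))
                               (trans (cong (inOrbit j) (sym i≡)) (inOrbit-iter a₀ j<n))
    ... | no j₀≢j with inOrbit-cases i j<n
    ...   | inj₁ 0≡ = trans (cong (χ (least? j) *_) 0≡) (*-zeroʳ (χ (least? j)))
    ...   | inj₂ j↝i = cong (_* inOrbit j i) (χ-¬T {least? j} (λ t → j₀≢j
            (≤-antisym (least-unique j<n least₀ j₀↝i j↝i) (least-unique j₀<n (to (T-least? j<n) t) j↝i j₀↝i))))

  cycles-∑ : (w : ℕ → ℕ) (L : ℕ) → (∀ {j} → j < n → w j * per j ≡ L) → L * cycles n f ≡ ∑ n w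
  cycles-∑ w L weighted = begin
    L * cycles n f
      ≡⟨ cong (L *_) (length-filterᵇ-upTo least? n) ⟩
    L * ∑ n (χ ∘ least?)
      ≡⟨ *-distribˡ-∑ n L (χ ∘ least?) ⟩
    ∑ n (λ j → L * χ (least? j))
      ≡⟨ ∑-cong n (λ {j} j<n → trans (*-comm L _) (cong (χ (least? j) *_) (sym (orbit-weight j<n)))) ⟩
    ∑ n (λ j → χ (least? j) * ∑ n (λ i → inOrbit j i * w i))
      ≡⟨ ∑-cong n (λ {j} _ → trans (*-distribˡ-∑ n (χ (least? j)) _)
                                   (∑-cong n (λ {i} _ → sym (*-assoc (χ (least? j)) (inOrbit j i) (w i))))) ⟩
    ∑ n (λ j → ∑ n (λ i → χ (least? j) * inOrbit j i * w i))
      ≡⟨ ∑-swap n n _ ⟩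
    ∑ n (λ i → ∑ n (λ j → χ (least? j) * inOrbit j i * w i))
      ≡⟨ ∑-cong n (λ {i} _ → sym (*-distribʳ-∑ n (w i) _)) ⟩
    ∑ n (λ i → ∑ n (λ j → χ (least? j) * inOrbit j i) * w i)
      ≡⟨ ∑-cong n (λ {i} i<n → trans (cong (_* w i) (∑-least-inOrbit i<n)) (*-identityˡ (w i))) ⟩
    ∑ n w ∎
    where
    open ≡-Reasoning
    weight-iter : ∀ {j} a → j < n → w (iter f a j) ≡ w j
    weight-iter {j} a j<n = *-cancelʳ-≡ (w (iter f a j)) (w j) (per j) {{per≢0 j<n}}
      (trans (cong (w (iter f a j) *_) (sym (per-iter a j<n))) (trans (weighted (iter-< a j<n)) (sym (weighted j<n))))
    orbit-weight : ∀ {j} → j < n → ∑ n (λ i → inOrbit j i * w i) ≡ L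
    orbit-weight {j} j<n = begin
      ∑ n (λ i → inOrbit j i * w i)     ≡⟨ ∑-inOrbit w j<n ⟩
      ∑ (per j) (λ a → w (iter f a j))  ≡⟨ ∑-cong (per j) (λ {a} _ → weight-iter a j<n) ⟩
      ∑ (per j) (λ _ → w j)             ≡⟨ ∑-const (per j) (w j) ⟩
      per j * w j                       ≡⟨ *-comm (per j) (w j) ⟩
      w j * per j                       ≡⟨ weighted j<n ⟩
      L                                 ∎

cycles-weighted : ∀ {n f per} → (∀ {j} → j < n → f j < n) → Periods n f per →
                  (w : ℕ → ℕ) (L : ℕ) .{{_ : NonZero L}} → (∀ {j} → j < n → w j * per j ≡ L) →
                  L * cycles n f ≡ ∑ n w
cycles-weighted {n} {f} {per} f<n periods w L weighted = CycleCount.cycles-∑ f<n periods per≢0 w L weighted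
  where
  per≢0 : ∀ {j} → j < n → NonZero (per j)
  per≢0 {j} j<n = ≢-nonZero λ per≡0 →
    ≢-nonZero⁻¹ L (trans (sym (weighted j<n)) (trans (cong (w j *_) per≡0) (*-zeroʳ (w j))))

prime∤⇒coprime : ∀ {q a} → Prime q → ¬ q ∣ a → Coprime q a
prime∤⇒coprime pq q∤a (d∣q , d∣a) with prime⇒irreducible pq d∣q
... | inj₁ d≡1  = d≡1
... | inj₂ refl = ⊥-elim (q∤a d∣a)

module Congruence (q : ℕ) .{{_ : NonZero q}} where

  infix 4 _≈_
  record _≈_ (a b : ℕ) : Set where
    constructor mod≡
    field %≡% : a % q ≡ b % q
  open _≈_ public

  ≈-setoid : Setoid 0ℓ 0ℓ
  ≈-setoid = record
    { Carrier = ℕ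
    ; _≈_ = _≈_
    ; isEquivalence = record
      { refl  = mod≡ refl
      ; sym   = λ a≈b → mod≡ (sym (%≡% a≈b))
      ; trans = λ a≈b b≈c → mod≡ (trans (%≡% a≈b) (%≡% b≈c))
      }
    }

  open Setoid ≈-setoid public using () renaming (refl to ≈-refl; sym to ≈-sym; trans to ≈-trans)
  module ≈-Reasoning = SetoidReasoning ≈-setoid

  ≈-reflexive : ∀ {a b} → a ≡ b → a ≈ b
  ≈-reflexive refl = ≈-refl

  %-≈ : ∀ a → a % q ≈ a
  %-≈ a = mod≡ (m%n%n≡m%n a q)

  +-cong : ∀ {a b c d} → a ≈ b → c ≈ d → a + c ≈ b + d
  +-cong {a} {b} {c} {d} (mod≡ a≡b) (mod≡ c≡d) = mod≡ (begin
    (a + c) % q               ≡⟨ %-distribˡ-+ a c q ⟩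
    (a % q + c % q) % q       ≡⟨ cong₂ (λ x y → (x + y) % q) a≡b c≡d ⟩
    (b % q + d % q) % q       ≡⟨ %-distribˡ-+ b d q ⟨
    (b + d) % q               ∎)
    where open ≡-Reasoning

  *-cong : ∀ {a b c d} → a ≈ b → c ≈ d → a * c ≈ b * d
  *-cong {a} {b} {c} {d} (mod≡ a≡b) (mod≡ c≡d) = mod≡ (begin
    (a * c) % q               ≡⟨ %-distribˡ-* a c q ⟩
    (a % q * (c % q)) % q     ≡⟨ cong₂ (λ x y → (x * y) % q) a≡b c≡d ⟩
    (b % q * (d % q)) % q     ≡⟨ %-distribˡ-* b d q ⟨
    (b * d) % q               ∎)
    where open ≡-Reasoning

  ^-congˡ : ∀ {a b} m → a ≈ b → a ^ m ≈ b ^ m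
  ^-congˡ zero    a≈b = ≈-refl
  ^-congˡ (suc m) a≈b = *-cong a≈b (^-congˡ m a≈b)

  +-∣ : ∀ a {z} → q ∣ z → a + z ≈ a
  +-∣ a q∣z = mod≡ (%-remove-+ʳ a q∣z)

  ∣∸ : ∀ {a b} → a ≈ b → q ∣ a ∸ b
  ∣∸ {a} {b} (mod≡ a≡b) = divides (a / q ∸ b / q) (begin
    a ∸ b                                     ≡⟨ cong₂ _∸_ (m≡m%n+[m/n]*n a q) (m≡m%n+[m/n]*n b q) ⟩
    (a % q + a / q * q) ∸ (b % q + b / q * q) ≡⟨ cong (λ x → (x + a / q * q) ∸ (b % q + b / q * q)) a≡b ⟩
    (b % q + a / q * q) ∸ (b % q + b / q * q) ≡⟨ [m+n]∸[m+o]≡n∸o (b % q) _ _ ⟩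
    a / q * q ∸ b / q * q                     ≡⟨ *-distribʳ-∸ q (a / q) (b / q) ⟨
    (a / q ∸ b / q) * q                       ∎)
    where open ≡-Reasoning

  +-∣⁻¹ : ∀ a {z} → a + z ≈ a → q ∣ z
  +-∣⁻¹ a {z} a+z≈a = subst (q ∣_) (m+n∸m≡n a z) (∣∸ a+z≈a)

  +-cancelˡ-≥ : ∀ a {b c} → c ≤ b → a + b ≈ a + c → b ≈ c
  +-cancelˡ-≥ a {b} {c} c≤b a+b≈a+c = begin
    b            ≡⟨ m+[n∸m]≡n c≤b ⟨
    c + (b ∸ c)  ≈⟨ +-∣ c (subst (q ∣_) ([m+n]∸[m+o]≡n∸o a b c) (∣∸ a+b≈a+c)) ⟩
    c            ∎
    where open ≈-Reasoning

  +-cancelˡ : ∀ a {b c} → a + b ≈ a + c → b ≈ c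
  +-cancelˡ a {b} {c} a+b≈a+c with ≤-total b c
  ... | inj₁ b≤c = ≈-sym (+-cancelˡ-≥ a b≤c (≈-sym a+b≈a+c))
  ... | inj₂ c≤b = +-cancelˡ-≥ a c≤b a+b≈a+c

  ≈⇒≡ : ∀ {a b} → a < q → b < q → a ≈ b → a ≡ b
  ≈⇒≡ {a} {b} a<q b<q (mod≡ a≡b) = trans (sym (m<n⇒m%n≡m a<q)) (trans a≡b (m<n⇒m%n≡m b<q))

  inverse : Prime q → ∀ {a} → ¬ q ∣ a → ∃ λ u → a * u ≈ 1
  inverse pq {a} q∤a with coprime-Bézout (prime∤⇒coprime pq q∤a)
  ... | Bézout.-+ x y eq = y , (begin
    a * y            ≡⟨ *-comm a y ⟩
    y * a            ≡⟨ eq ⟨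
    1 + x * q        ≈⟨ +-∣ 1 (n∣m*n x) ⟩
    1                ∎)
    where open ≈-Reasoning
  ... | Bézout.+- x y eq = y * (q ∸ 1) , (begin
    a * (y * (q ∸ 1))               ≈⟨ +-∣ _ (n∣m*n x) ⟨
    a * (y * (q ∸ 1)) + x * q       ≡⟨ cong (a * (y * (q ∸ 1)) +_) eq ⟨
    a * (y * (q ∸ 1)) + (1 + y * a) ≡⟨ trans (regroup a y (q ∸ 1)) (cong (λ q → 1 + y * a * q) (suc-pred q)) ⟩
    1 + y * a * q                   ≈⟨ +-∣ 1 (n∣m*n (y * a)) ⟩
    1                               ∎)
    where
    open ≈-Reasoning
    regroup : ∀ a y q′ → a * (y * q′) + (1 + y * a) ≡ 1 + y * a * suc q′
    regroup = solve-∀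

  order-∣ : ∀ {r k} → IsMultOrder q r k → ∀ m → r ^ m ≈ 1 ⇔ k ∣ m
  order-∣ {r} {k} (k≥1 , r^k≡1 , minimal) m = mk⇔ ⇒ ⇐
    where
    instance
      k≢0 : NonZero k
      k≢0 = >-nonZero k≥1
    ⇐ : ∀ {m} → k ∣ m → r ^ m ≈ 1
    ⇐ (divides c refl) = begin
      r ^ (c * k)  ≡⟨ cong (r ^_) (*-comm c k) ⟩
      r ^ (k * c)  ≡⟨ ^-*-assoc r k c ⟨
      (r ^ k) ^ c  ≈⟨ ^-congˡ c (mod≡ r^k≡1) ⟩
      1 ^ c        ≡⟨ ^-zeroˡ c ⟩
      1            ∎
      where open ≈-Reasoning
    ⇒ : r ^ m ≈ 1 → k ∣ m
    ⇒ r^m≈1 = m%n≡0⇒n∣m m k (s≡0 (m % k) refl)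
      where
      r^s≈1 : r ^ (m % k) ≈ 1
      r^s≈1 = begin
        r ^ (m % k)                    ≡⟨ *-identityʳ _ ⟨
        r ^ (m % k) * 1                ≈⟨ *-cong (≈-refl {r ^ (m % k)}) (⇐ (n∣m*n (m / k))) ⟨
        r ^ (m % k) * r ^ (m / k * k)  ≡⟨ ^-distribˡ-+-* r (m % k) (m / k * k) ⟨
        r ^ (m % k + m / k * k)        ≡⟨ cong (r ^_) (m≡m%n+[m/n]*n m k) ⟨
        r ^ m                          ≈⟨ r^m≈1 ⟩
        1                              ∎
        where open ≈-Reasoning
      s≡0 : ∀ s → m % k ≡ s → s ≡ 0
      s≡0 zero    _  = refl
      s≡0 (suc s) eq = ⊥-elim (<⇒≱ (m%n<n m k)
        (subst (k ≤_) (sym eq) (minimal (suc s) (s≤s z≤n) (%≡% (subst (λ e → r ^ e ≈ 1) eq r^s≈1)))))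

module Affine (q : ℕ) .{{_ : NonZero q}} (r t : ℕ) where
  open Congruence q
  open ≈-Reasoning

  g : ℕ → ℕ
  g = autV q r t

  g≈ : ∀ y → g y ≈ r * y + t
  g≈ y = %-≈ (r * y + t)

  iter-g< : ∀ m {y} → y < q → iter g m y < q
  iter-g< = iter-closed (λ _ → m%n<n _ q)

  iter-translation : r % q ≡ 1 % q → ∀ m y → iter g m y ≈ y + m * t
  iter-translation r≡1 zero    y = ≈-reflexive (sym (+-identityʳ y))
  iter-translation r≡1 (suc m) y = begin
    g (iter g m y)        ≈⟨ g≈ _ ⟩
    r * iter g m y + t    ≈⟨ +-cong (*-cong (mod≡ r≡1) (iter-translation r≡1 m y)) ≈-refl ⟩
    1 * (y + m * t) + t   ≡⟨ regroup y m t ⟩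
    y + suc m * t         ∎
    where
    regroup : ∀ y m t → 1 * (y + m * t) + t ≡ y + suc m * t
    regroup = solve-∀

  translation-fixed⇔ : r % q ≡ 1 % q → ∀ {y} m → y < q → iter g m y ≡ y ⇔ q ∣ m * t
  translation-fixed⇔ r≡1 {y} m y<q = mk⇔
    (λ fixed → +-∣⁻¹ y (≈-trans (≈-sym (iter-translation r≡1 m y)) (≈-reflexive fixed)))
    (λ q∣mt → ≈⇒≡ (iter-g< m y<q) y<q (≈-trans (iter-translation r≡1 m y) (+-∣ y q∣mt)))

  translation-periods-∣ : r % q ≡ 1 % q → q ∣ t → Periods q g (λ _ → 1)
  translation-periods-∣ r≡1 q∣t m y<q =
    mk⇔ (λ _ → 1∣ m) (λ _ → from (translation-fixed⇔ r≡1 m y<q) (∣n⇒∣m*n m q∣t))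

  translation-periods-∤ : Prime q → r % q ≡ 1 % q → ¬ q ∣ t → Periods q g (λ _ → q)
  translation-periods-∤ pq r≡1 q∤t m y<q = mk⇔
    (λ fixed → [ id , ⊥-elim ∘ q∤t ]′ (euclidsLemma m t pq (to (translation-fixed⇔ r≡1 m y<q) fixed)))
    (λ q∣m → from (translation-fixed⇔ r≡1 m y<q) (∣m⇒∣m*n t q∣m))

  module NonTranslation (pq : Prime q) .{{_ : NonZero r}} (r≢1 : ¬ r % q ≡ 1 % q) where

    r≡1+[r∸1] : r ≡ 1 + (r ∸ 1)
    r≡1+[r∸1] = sym (suc-pred r)

    q∤r∸1 : ¬ q ∣ r ∸ 1
    q∤r∸1 q∣r∸1 = r≢1 (%≡% (≈-trans (≈-reflexive r≡1+[r∸1]) (+-∣ 1 q∣r∸1)))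

    u : ℕ
    u = proj₁ (inverse pq q∤r∸1)

    -- the solution of (r - 1) c ≡ - t, namely (q - 1) t u with u an inverse of r - 1
    centre : ℕ
    centre = (t * (q ∸ 1) * u) % q

    centre<q : centre < q
    centre<q = m%n<n _ q

    r*centre+t≈centre : r * centre + t ≈ centre
    r*centre+t≈centre = begin
      r * c + t
        ≡⟨ cong (λ r → r * c + t) r≡1+[r∸1] ⟩
      (1 + (r ∸ 1)) * c + t
        ≡⟨ expand (r ∸ 1) c t ⟩
      c + ((r ∸ 1) * c + t)
        ≈⟨ +-cong (≈-refl {c}) (+-cong (*-cong (≈-refl {r ∸ 1}) (%-≈ _)) (≈-refl {t})) ⟩
      c + ((r ∸ 1) * (t * (q ∸ 1) * u) + t)
        ≡⟨ cong (λ x → c + (x + t)) (swap (r ∸ 1) t (q ∸ 1) u) ⟩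
      c + ((r ∸ 1) * u * (t * (q ∸ 1)) + t)
        ≈⟨ +-cong (≈-refl {c}) (+-cong (*-cong (proj₂ (inverse pq q∤r∸1)) ≈-refl) ≈-refl) ⟩
      c + (1 * (t * (q ∸ 1)) + t)
        ≡⟨ cong (c +_) (trans (collect t (q ∸ 1)) (cong (t *_) (suc-pred q))) ⟩
      c + t * q
        ≈⟨ +-∣ c (n∣m*n t) ⟩
      c ∎
      where
      c = centre
      expand : ∀ s c t → (1 + s) * c + t ≡ c + (s * c + t)
      expand = solve-∀
      swap : ∀ s t q′ u → s * (t * q′ * u) ≡ s * u * (t * q′)
      swap = solve-∀
      collect : ∀ t q′ → 1 * (t * q′) + t ≡ t * suc q′
      collect = solve-∀

    g-centre : g centre ≡ centre
    g-centre = ≈⇒≡ (m%n<n _ q) centre<q (≈-trans (g≈ centre) r*centre+t≈centre)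

    iter-centre : ∀ m → iter g m centre ≡ centre
    iter-centre zero    = refl
    iter-centre (suc m) = trans (cong g (iter-centre m)) g-centre

    iter-offset : ∀ {y d} → y ≈ centre + d → ∀ m → iter g m y ≈ centre + r ^ m * d
    iter-offset {y} {d} y≈ zero    = ≈-trans y≈ (≈-reflexive (cong (centre +_) (sym (*-identityˡ d))))
    iter-offset {y} {d} y≈ (suc m) = begin
      g (iter g m y)                   ≈⟨ g≈ _ ⟩
      r * iter g m y + t               ≈⟨ +-cong (*-cong (≈-refl {r}) (iter-offset y≈ m)) ≈-refl ⟩
      r * (centre + r ^ m * d) + t     ≡⟨ regroup r centre (r ^ m) d t ⟩
      (r * centre + t) + r * r ^ m * d ≈⟨ +-cong r*centre+t≈centre ≈-refl ⟩
      centre + r * r ^ m * d           ∎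
      where
      regroup : ∀ r c x d t → r * (c + x * d) + t ≡ (r * c + t) + r * x * d
      regroup = solve-∀

    offset : ∀ y → y ≈ centre + (y + (q ∸ centre))
    offset y = ≈-sym (begin
      centre + (y + (q ∸ centre)) ≡⟨ +-comm-middle centre y (q ∸ centre) ⟩
      y + (centre + (q ∸ centre)) ≡⟨ cong (y +_) (m+[n∸m]≡n (<⇒≤ centre<q)) ⟩
      y + q                       ≈⟨ +-∣ y ∣-refl ⟩
      y                           ∎)
      where
      +-comm-middle : ∀ a b c → a + (b + c) ≡ b + (a + c)
      +-comm-middle = solve-∀

    fixed⇔r^m≈1 : ∀ {y} m → y < q → y ≢ centre → iter g m y ≡ y ⇔ r ^ m ≈ 1
    fixed⇔r^m≈1 {y} m y<q y≢c = mk⇔ ⇒ ⇐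
      where
      d = y + (q ∸ centre)
      ⇐ : r ^ m ≈ 1 → iter g m y ≡ y
      ⇐ r^m≈1 = ≈⇒≡ (iter-g< m y<q) y<q (begin
        iter g m y          ≈⟨ iter-offset (offset y) m ⟩
        centre + r ^ m * d  ≈⟨ +-cong (≈-refl {centre}) (*-cong r^m≈1 (≈-refl {d})) ⟩
        centre + 1 * d      ≡⟨ cong (centre +_) (*-identityˡ d) ⟩
        centre + d          ≈⟨ offset y ⟨
        y                   ∎)
      ⇒ : iter g m y ≡ y → r ^ m ≈ 1
      ⇒ fixed = [ r^m≈1 , ⊥-elim ∘ q∤d ]′ (euclidsLemma (r ^ m ∸ 1) d pq q∣[r^m∸1]*d)
        where
        instance
          r^m≢0 : NonZero (r ^ m)
          r^m≢0 = m^n≢0 r m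
        r^m*d≈d : r ^ m * d ≈ 1 * d
        r^m*d≈d = +-cancelˡ centre (begin
          centre + r ^ m * d  ≈⟨ iter-offset (offset y) m ⟨
          iter g m y          ≡⟨ fixed ⟩
          y                   ≈⟨ offset y ⟩
          centre + d          ≡⟨ cong (centre +_) (*-identityˡ d) ⟨
          centre + 1 * d      ∎)
        q∣[r^m∸1]*d : q ∣ (r ^ m ∸ 1) * d
        q∣[r^m∸1]*d = subst (q ∣_) (sym (*-distribʳ-∸ d (r ^ m) 1)) (∣∸ r^m*d≈d)
        r^m≈1 : q ∣ r ^ m ∸ 1 → r ^ m ≈ 1
        r^m≈1 q∣ = ≈-trans (≈-reflexive (sym (suc-pred (r ^ m)))) (+-∣ 1 q∣)
        q∤d : ¬ q ∣ d
        q∤d q∣d = y≢c (≈⇒≡ y<q centre<q (≈-trans (offset y) (+-∣ centre q∣d)))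

    periods : ∀ {k} → IsMultOrder q r k → Periods q g (λ y → if y ≡ᵇ centre then 1 else k)
    periods {k} ord {y} m y<q with y ≡ᵇ centre in eq
    ... | true  = mk⇔ (λ _ → 1∣ m)
      (λ _ → subst (λ y → iter g m y ≡ y) (sym (≡ᵇ⇒≡ y centre (from T-≡ eq))) (iter-centre m))
    ... | false = order-∣ ord m ⇔-∘ fixed⇔r^m≈1 m y<q (λ y≡c → subst T eq (≡⇒≡ᵇ y centre y≡c))

    twoPeriods : ∀ {k} → IsMultOrder q r k → TwoPeriods q g
    twoPeriods {k} ord = record
      { centre = centre ; centre<q = centre<q ; period = λ b → if b then 1 else k ; periods = periods ord }

m∣n⇒lcm[m,n]≡n : ∀ {m n} → m ∣ n → lcm m n ≡ n
m∣n⇒lcm[m,n]≡n {m} {n} m∣n = ∣-antisym (lcm-least m∣n ∣-refl) (n∣lcm[m,n] m n)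

n∣m⇒lcm[m,n]≡m : ∀ {m n} → n ∣ m → lcm m n ≡ m
n∣m⇒lcm[m,n]≡m {m} {n} n∣m = ∣-antisym (lcm-least ∣-refl n∣m) (m∣lcm[m,n] m n)

lcm[1,n]≡n : ∀ n → lcm 1 n ≡ n
lcm[1,n]≡n n = m∣n⇒lcm[m,n]≡n (1∣ n)

lcm[n,1]≡n : ∀ n → lcm n 1 ≡ n
lcm[n,1]≡n n = n∣m⇒lcm[m,n]≡m (1∣ n)

coprime⇒lcm[m,n]≡m*n : ∀ {m n} → Coprime m n → lcm m n ≡ m * n
coprime⇒lcm[m,n]≡m*n {m} {n} coprime = begin
  lcm m n            ≡⟨ *-identityˡ (lcm m n) ⟨
  1 * lcm m n        ≡⟨ cong (_* lcm m n) (coprime⇒gcd≡1 coprime) ⟨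
  gcd m n * lcm m n  ≡⟨ gcd*lcm m n ⟩
  m * n              ∎
  where open ≡-Reasoning

m∣n⇒gcd[m,n]≡m : ∀ {m n} → m ∣ n → gcd m n ≡ m
m∣n⇒gcd[m,n]≡m {m} {n} m∣n = ∣-antisym (gcd[m,n]∣m m n) (gcd-greatest ∣-refl m∣n)

n∣m⇒gcd[m,n]≡n : ∀ {m n} → n ∣ m → gcd m n ≡ n
n∣m⇒gcd[m,n]≡n {m} {n} n∣m = ∣-antisym (gcd[m,n]∣n m n) (gcd-greatest n∣m ∣-refl)

coprime-∣⇒*∣ : ∀ {m n x} → Coprime m n → m ∣ x → n ∣ x → m * n ∣ x
coprime-∣⇒*∣ {m} {n} coprime m∣x (divides c refl) =
  *-monoˡ-∣ n (coprime-divisor coprime (subst (m ∣_) (*-comm c n) m∣x))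

∣∧<⇒≡0 : ∀ {d x} → d ∣ x → x < d → x ≡ 0
∣∧<⇒≡0 {d} {zero}  _   _   = refl
∣∧<⇒≡0 {d} {suc x} d∣x x<d = ⊥-elim (<⇒≱ x<d (∣⇒≤ d∣x))

module CRT (m q : ℕ) .{{_ : NonZero m}} .{{_ : NonZero q}} (coprime : Coprime m q) where

  crt-unique-≤ : ∀ {a b} → b ≤ a → a < m * q → a % m ≡ b % m → a % q ≡ b % q → b ≡ a
  crt-unique-≤ {a} {b} b≤a a<mq a≡b[m] a≡b[q] =
    ≤-antisym b≤a (m∸n≡0⇒m≤n (∣∧<⇒≡0 mq∣a∸b (≤-<-trans (m∸n≤m a b) a<mq)))
    where
    mq∣a∸b : m * q ∣ a ∸ b
    mq∣a∸b = coprime-∣⇒*∣ coprime (Congruence.∣∸ m (Congruence.mod≡ a≡b[m]))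
                                  (Congruence.∣∸ q (Congruence.mod≡ a≡b[q]))

  crt-unique : ∀ {a b} → a < m * q → b < m * q → a % m ≡ b % m → a % q ≡ b % q → a ≡ b
  crt-unique {a} {b} a<mq b<mq a≡b[m] a≡b[q] with ≤-total b a
  ... | inj₁ b≤a = sym (crt-unique-≤ b≤a a<mq a≡b[m] a≡b[q])
  ... | inj₂ a≤b = crt-unique-≤ a≤b b<mq (sym a≡b[m]) (sym a≡b[q])

  count : ℕ → ℕ → ℕ
  count x y = ∑ (m * q) (λ j → δ (j % m) x * δ (j % q) y)

  count-from : ∀ {j₀} → j₀ < m * q → count (j₀ % m) (j₀ % q) ≡ 1
  count-from {j₀} j₀<mq = trans (∑-cong (m * q) term) (∑-δ₁ (m * q) j₀<mq)
    where
    term : ∀ {j} → j < m * q → δ (j % m) (j₀ % m) * δ (j % q) (j₀ % q) ≡ δ j₀ j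
    term {j} j<mq with j₀ ≟ j
    ... | yes refl = cong₂ _*_ (δ-refl (j₀ % m)) (δ-refl (j₀ % q))
    ... | no j₀≢j with j % m ≟ j₀ % m | j % q ≟ j₀ % q
    ...   | yes ≡[m] | yes ≡[q] = ⊥-elim (j₀≢j (crt-unique j₀<mq j<mq (sym ≡[m]) (sym ≡[q])))
    ...   | yes _    | no _     = refl
    ...   | no _     | _        = refl

  count≤1 : ∀ x y → count x y ≤ 1
  count≤1 x y with count x y in eq
  ... | zero  = z≤n
  ... | suc _ with ∑-positive (m * q) (λ j → δ (j % m) x * δ (j % q) y) (subst (0 <_) (sym eq) z<s)
  ...   | j₀ , j₀<mq , pos with δ*δ>0 {j₀ % m} {x} {j₀ % q} {y} pos
  ...     | refl , refl = ≤-reflexive (trans (sym eq) (count-from j₀<mq))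

  δ-expand : ∀ {a b} (G : ℕ → ℕ → ℕ) → a < m → b < q →
             ∑ m (λ x → ∑ q (λ y → δ a x * (δ b y * G x y))) ≡ G a b
  δ-expand {a} {b} G a<m b<q = begin
    ∑ m (λ x → ∑ q (λ y → δ a x * (δ b y * G x y)))
      ≡⟨ ∑-cong m (λ {x} _ → *-distribˡ-∑ q (δ a x) _) ⟨
    ∑ m (λ x → δ a x * ∑ q (λ y → δ b y * G x y))
      ≡⟨ ∑-cong m (λ {x} _ → cong (δ a x *_) (∑-δ q (G x) b<q)) ⟩
    ∑ m (λ x → δ a x * G x b)
      ≡⟨ ∑-δ m (λ x → G x b) a<m ⟩
    G a b ∎
    where open ≡-Reasoning

  ∑-count : ∀ (G : ℕ → ℕ → ℕ) →
            ∑ (m * q) (λ j → G (j % m) (j % q)) ≡ ∑ m (λ x → ∑ q (λ y → count x y * G x y))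
  ∑-count G = begin
    ∑ (m * q) (λ j → G (j % m) (j % q))
      ≡⟨ ∑-cong (m * q) (λ {j} _ → δ-expand G (m%n<n j m) (m%n<n j q)) ⟨
    ∑ (m * q) (λ j → ∑ m (λ x → ∑ q (λ y → δ (j % m) x * (δ (j % q) y * G x y))))
      ≡⟨ ∑-swap₃ (m * q) m q _ ⟩
    ∑ m (λ x → ∑ q (λ y → ∑ (m * q) (λ j → δ (j % m) x * (δ (j % q) y * G x y))))
      ≡⟨ ∑-cong m (λ {x} _ → ∑-cong q (λ {y} _ → trans
           (∑-cong (m * q) (λ {j} _ → sym (*-assoc (δ (j % m) x) (δ (j % q) y) (G x y))))
           (sym (*-distribʳ-∑ (m * q) (G x y) _)))) ⟩
    ∑ m (λ x → ∑ q (λ y → count x y * G x y))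
      ∎
    where open ≡-Reasoning

  ∑∑-count : ∑ m (λ x → ∑ q (count x)) ≡ m * q
  ∑∑-count = begin
    ∑ m (λ x → ∑ q (count x))
      ≡⟨ ∑-cong m (λ {x} _ → ∑-cong q (λ {y} _ → *-identityʳ (count x y))) ⟨
    ∑ m (λ x → ∑ q (λ y → count x y * 1))      ≡⟨ ∑-count (λ _ _ → 1) ⟨
    ∑ (m * q) (λ _ → 1)                        ≡⟨ ∑-const (m * q) 1 ⟩
    m * q * 1                                  ≡⟨ *-identityʳ (m * q) ⟩
    m * q                                      ∎
    where open ≡-Reasoning

  -- Each of the m q residue pairs is hit at most once by the m q numbers below m q, hence exactly once.
  count≡1 : ∀ {x y} → x < m → y < q → count x y ≡ 1
  count≡1 {x} {y} x<m y<q =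
    ∑-tight q (count x) 1 (λ {y} _ → count≤1 x y) (trans row (sym (*-identityʳ q))) y<q
    where
    row≤q : ∀ {x} → x < m → ∑ q (count x) ≤ q
    row≤q {x} _ = ≤-trans (∑-mono-≤ q (λ {y} _ → count≤1 x y))
                          (≤-reflexive (trans (∑-const q 1) (*-identityʳ q)))
    row : ∑ q (count x) ≡ q
    row = ∑-tight m (λ x → ∑ q (count x)) q row≤q ∑∑-count x<m

  ∑-crt : ∀ (G : ℕ → ℕ → ℕ) → ∑ (m * q) (λ j → G (j % m) (j % q)) ≡ ∑ m (λ x → ∑ q (G x))
  ∑-crt G = trans (∑-count G) (∑-cong m (λ {x} x<m → ∑-cong q (λ {y} y<q →
    trans (cong (_* G x y) (count≡1 x<m y<q)) (*-identityˡ (G x y)))))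

  module _ {f g h : ℕ → ℕ} (f<mq : ∀ {j} → j < m * q → f j < m * q)
           (f%m : ∀ j → f j % m ≡ g (j % m)) (f%q : ∀ j → f j % q ≡ h (j % q)) where

    periods-product : ∀ {P Q} → Periods m g P → Periods q h Q →
                      Periods (m * q) f (λ j → lcm (P (j % m)) (Q (j % q)))
    periods-product {P} {Q} periods-g periods-h {j} a j<mq = mk⇔
      (λ fixed → lcm-least (to (periods-g a j%m<m) (fixed-mod f%m fixed))
                           (to (periods-h a j%q<q) (fixed-mod f%q fixed)))
      (λ lcm∣a → crt-unique (iter-closed f<mq a j<mq) j<mq
        (trans (iter-% f%m a j) (from (periods-g a j%m<m) (∣-trans (m∣lcm[m,n] _ _) lcm∣a)))
        (trans (iter-% f%q a j) (from (periods-h a j%q<q) (∣-trans (n∣lcm[m,n] (P (j % m)) _) lcm∣a))))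
      where
      j%m<m = m%n<n j m
      j%q<q = m%n<n j q
      fixed-mod : ∀ {d} .{{_ : NonZero d}} {k} → (∀ j → f j % d ≡ k (j % d)) →
                  iter f a j ≡ j → iter k a (j % d) ≡ j % d
      fixed-mod {d} f%d fixed = trans (sym (iter-% f%d a j)) (cong (_% d) fixed)

    cycles-uniform : ∀ {a b} e .{{_ : NonZero e}} → lcm a b ≡ e →
                     Periods m g (λ _ → a) → Periods q h (λ _ → b) → e * cycles (m * q) f ≡ m * q
    cycles-uniform e lcm≡e periods-g periods-h = begin
      e * cycles (m * q) f
        ≡⟨ cycles-weighted f<mq (periods-product periods-g periods-h) (λ _ → 1) e (λ _ → trans (*-identityˡ _) lcm≡e) ⟩
      ∑ (m * q) (λ _ → 1)   ≡⟨ ∑-const (m * q) 1 ⟩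
      m * q * 1             ≡⟨ *-identityʳ (m * q) ⟩
      m * q                 ∎
      where open ≡-Reasoning

    cycles-twoPeriods : (G : TwoPeriods m g) (H : TwoPeriods q h)
                        (W : Bool → Bool → ℕ) (L : ℕ) .{{_ : NonZero L}} →
                        (∀ a b → W a b * lcm (TwoPeriods.period G a) (TwoPeriods.period H b) ≡ L) →
                        L * cycles (m * q) f ≡
                          W true true + (q ∸ 1) * W true false + (m ∸ 1) * (W false true + (q ∸ 1) * W false false)
    cycles-twoPeriods G H W L weights = begin
      L * cycles (m * q) f
        ≡⟨ cycles-weighted f<mq (periods-product G.periods H.periods) w L (λ _ → weights _ _) ⟩
      ∑ (m * q) w
        ≡⟨ ∑-crt (λ x y → W (x ≡ᵇ G.centre) (y ≡ᵇ H.centre)) ⟩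
      ∑ m (λ x → ∑ q (λ y → W (x ≡ᵇ G.centre) (y ≡ᵇ H.centre)))
        ≡⟨ ∑-cong m (λ {x} _ → ∑-≡ᵇ q (W (x ≡ᵇ G.centre)) H.centre<q) ⟩
      ∑ m (λ x → W (x ≡ᵇ G.centre) true + (q ∸ 1) * W (x ≡ᵇ G.centre) false)
        ≡⟨ ∑-≡ᵇ m (λ a → W a true + (q ∸ 1) * W a false) G.centre<q ⟩
      W true true + (q ∸ 1) * W true false + (m ∸ 1) * (W false true + (q ∸ 1) * W false false)
        ∎
      where
      open ≡-Reasoning
      module G = TwoPeriods G
      module H = TwoPeriods H
      w : ℕ → ℕ
      w j = W (j % m ≡ᵇ G.centre) (j % q ≡ᵇ H.centre)

autV-% : ∀ {n d} .{{_ : NonZero n}} .{{_ : NonZero d}} r t → d ∣ n → ∀ j → autV n r t j % d ≡ autV d r t (j % d)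
autV-% {n} {d} r t d∣n j = begin
  (r * j + t) % n % d     ≡⟨ m∣n⇒o%n%m≡o%m d n (r * j + t) d∣n ⟩
  (r * j + t) % d         ≡⟨ %≡% (+-cong (*-cong (≈-refl {r}) (≈-sym (%-≈ j))) (≈-refl {t})) ⟩
  (r * (j % d) + t) % d   ∎
  where
  open ≡-Reasoning
  open Congruence d

m*x≡m*y+z⇒x≡y+z/m : ∀ m .{{_ : NonZero m}} {x y z} → m * x ≡ m * y + z → x ≡ y + z / m
m*x≡m*y+z⇒x≡y+z/m m {x} {y} {z} eq = begin
  x                  ≡⟨ m+[n∸m]≡n y≤x ⟨
  y + (x ∸ y)        ≡⟨ cong (y +_) (m*n/n≡m (x ∸ y) m) ⟨
  y + (x ∸ y) * m / m ≡⟨ cong (λ w → y + w / m) (trans (*-comm (x ∸ y) m) m*[x∸y]≡z) ⟩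
  y + z / m          ∎
  where
  open ≡-Reasoning
  y≤x : y ≤ x
  y≤x = *-cancelˡ-≤ m (≤-trans (m≤m+n (m * y) z) (≤-reflexive (sym eq)))
  m*[x∸y]≡z : m * (x ∸ y) ≡ z
  m*[x∸y]≡z = trans (*-distribˡ-∸ m x y) (trans (cong (_∸ m * y) eq) (m+n∸m≡n (m * y) z))

prime[3] : Prime 3
prime[3] = from-yes (prime? 3)

module Affine3p (p : ℕ) .{{_ : NonZero p}} (p-prime : Prime p) (p>3 : 3 < p) (r t : ℕ) .{{_ : NonZero r}} where

  instance
    3p≢0 : NonZero (3 * p)
    3p≢0 = m*n≢0 3 p

  1<p : 1 < p
  1<p = <-trans (s≤s (s≤s z≤n)) p>3

  3∤p : ¬ 3 ∣ p
  3∤p 3∣p with prime⇒irreducible p-prime 3∣p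
  ... | inj₂ 3≡p = <⇒≢ p>3 3≡p

  2∤p : ¬ 2 ∣ p
  2∤p 2∣p with prime⇒irreducible p-prime 2∣p
  ... | inj₂ 2≡p = <⇒≢ (<-trans (n<1+n 2) p>3) 2≡p

  p∤3 : ¬ p ∣ 3
  p∤3 p∣3 = <⇒≱ p>3 (∣⇒≤ p∣3)

  p∤1 : ¬ p ∣ 1
  p∤1 p∣1 = <⇒≱ 1<p (∣⇒≤ p∣1)

  3∤1 : ¬ 3 ∣ 1
  3∤1 3∣1 with ∣⇒≤ 3∣1
  ... | s≤s ()

  1%p≡1 : 1 % p ≡ 1
  1%p≡1 = m<n⇒m%n≡m 1<p

  coprime[3,p] : Coprime 3 p
  coprime[3,p] = prime∤⇒coprime prime[3] 3∤p

  open CRT 3 p coprime[3,p]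
  module Mod3 = Affine 3 r t
  module Modp = Affine p r t

  r≢1[3] : r % 3 ≡ 2 → ¬ r % 3 ≡ 1 % 3
  r≢1[3] r≡2 r≡1 with trans (sym r≡2) r≡1
  ... | ()

  order-2[3] : r % 3 ≡ 2 → IsMultOrder 3 r 2
  order-2[3] r≡2 = s≤s z≤n , Congruence.%≡% (Congruence.^-congˡ 3 {r} {2} 2 (Congruence.mod≡ r≡2)) , minimal
    where
    minimal : ∀ m → 1 ≤ m → r ^ m % 3 ≡ 1 % 3 → 2 ≤ m
    minimal (suc zero)    _ r≡1 = ⊥-elim (r≢1[3] r≡2 (trans (cong (_% 3) (sym (*-identityʳ r))) r≡1))
    minimal (suc (suc m)) _ _   = s≤s (s≤s z≤n)

  r≢1⇒r≢1[p] : r < 3 * p → r ≢ 1 → r % 3 ≡ 1 → ¬ r % p ≡ 1 % p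
  r≢1⇒r≢1[p] r<3p r≢1 r≡1[3] r≡1[p] =
    r≢1 (crt-unique r<3p (<-≤-trans (s≤s (s≤s z≤n)) (m≤m*n 3 p)) r≡1[3] r≡1[p])

  uniform₃ : ∀ {a} → Periods 3 (autV 3 r t) (λ _ → a) → TwoPeriods 3 (autV 3 r t)
  uniform₃ = uniformPeriods _ (s≤s z≤n)

  uniformₚ : ∀ {b} → Periods p (autV p r t) (λ _ → b) → TwoPeriods p (autV p r t)
  uniformₚ = uniformPeriods _ (>-nonZero⁻¹ p)

  affine₃ : r % 3 ≡ 2 → TwoPeriods 3 (autV 3 r t)
  affine₃ r≡2 = Mod3.NonTranslation.twoPeriods prime[3] (r≢1[3] r≡2) (order-2[3] r≡2)

  affineₚ : ∀ {k} → ¬ r % p ≡ 1 % p → IsMultOrder p r k → TwoPeriods p (autV p r t)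
  affineₚ r≢1 = Modp.NonTranslation.twoPeriods p-prime r≢1

  f<3p : ∀ {j} → j < 3 * p → autV (3 * p) r t j < 3 * p
  f<3p _ = m%n<n _ (3 * p)

  cV3p-uniform : ∀ {a b} e .{{_ : NonZero e}} → lcm a b ≡ e →
                 Periods 3 (autV 3 r t) (λ _ → a) → Periods p (autV p r t) (λ _ → b) →
                 ∀ {c} → e * c ≡ 3 * p → cV3p p r t ≡ c
  cV3p-uniform e lcm≡e periods₃ periodsₚ e*c≡3p = *-cancelˡ-≡ _ _ e (trans
    (cycles-uniform f<3p (autV-% {3 * p} r t (m∣m*n p)) (autV-% {3 * p} r t (n∣m*n 3)) e lcm≡e periods₃ periodsₚ)
    (sym e*c≡3p))

  cV3p-twoPeriods : (G : TwoPeriods 3 (autV 3 r t)) (H : TwoPeriods p (autV p r t))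
                    (W : Bool → Bool → ℕ) (L : ℕ) .{{_ : NonZero L}} →
                    (∀ a b → W a b * lcm (TwoPeriods.period G a) (TwoPeriods.period H b) ≡ L) →
                    L * cV3p p r t ≡ W true true + (p ∸ 1) * W true false + 2 * (W false true + (p ∸ 1) * W false false)
  cV3p-twoPeriods = cycles-twoPeriods f<3p (autV-% {3 * p} r t (m∣m*n p)) (autV-% {3 * p} r t (n∣m*n 3))

  cV3p-r≡1 : r ≡ 1 → (t ≡ 1 ⊎ t ≡ 3 ⊎ t ≡ p ⊎ t ≡ 3 * p) → cV3p p r t ≡ gcd (3 * p) t
  cV3p-r≡1 refl (inj₁ refl) = trans
    (cV3p-uniform (3 * p) (coprime⇒lcm[m,n]≡m*n coprime[3,p])
      (Mod3.translation-periods-∤ prime[3] refl 3∤1) (Modp.translation-periods-∤ p-prime refl p∤1)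
      (*-identityʳ (3 * p)))
    (sym (gcd-zeroʳ (3 * p)))
  cV3p-r≡1 refl (inj₂ (inj₁ refl)) = trans
    (cV3p-uniform p (lcm[1,n]≡n p)
      (Mod3.translation-periods-∣ refl ∣-refl) (Modp.translation-periods-∤ p-prime refl p∤3)
      (*-comm p 3))
    (sym (n∣m⇒gcd[m,n]≡n (m∣m*n p)))
  cV3p-r≡1 refl (inj₂ (inj₂ (inj₁ t≡p))) = trans
    (cV3p-uniform 3 (lcm[n,1]≡n 3)
      (Mod3.translation-periods-∤ prime[3] refl (3∤p ∘ subst (3 ∣_) t≡p))
      (Modp.translation-periods-∣ refl (subst (p ∣_) (sym t≡p) ∣-refl))
      {p} refl)
    (sym (trans (cong (gcd (3 * p)) t≡p) (n∣m⇒gcd[m,n]≡n (n∣m*n 3 {p}))))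
  cV3p-r≡1 refl (inj₂ (inj₂ (inj₂ refl))) = trans
    (cV3p-uniform 1 (lcm[1,n]≡n 1)
      (Mod3.translation-periods-∣ refl (m∣m*n p)) (Modp.translation-periods-∣ refl (n∣m*n 3))
      (*-identityˡ (3 * p)))
    (sym (n∣m⇒gcd[m,n]≡n ∣-refl))

  cV3p-r≡2[3]-r≡1[p]-p∣t : r % 3 ≡ 2 → r % p ≡ 1 % p → p ∣ t → cV3p p r t ≡ 2 * p
  cV3p-r≡2[3]-r≡1[p]-p∣t r≡2[3] r≡1[p] p∣t = *-cancelˡ-≡ _ _ 2 (begin
    2 * cV3p p r t                           ≡⟨ cV3p-twoPeriods (affine₃ r≡2[3]) H W 2 weights ⟩
    2 + (p ∸ 1) * 2 + 2 * (1 + (p ∸ 1) * 1)  ≡⟨ arith (p ∸ 1) ⟩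
    2 * (2 * suc (p ∸ 1))                    ≡⟨ cong (λ p → 2 * (2 * p)) (suc-pred p) ⟩
    2 * (2 * p)                              ∎)
    where
    open ≡-Reasoning
    H = uniformₚ (Modp.translation-periods-∣ r≡1[p] p∣t)
    W : Bool → Bool → ℕ
    W a _ = if a then 2 else 1
    weights : ∀ a b → W a b * lcm (if a then 1 else 2) 1 ≡ 2
    weights true  _ = cong (2 *_) (lcm[1,n]≡n 1)
    weights false _ = trans (*-identityˡ _) (lcm[n,1]≡n 2)
    arith : ∀ p′ → 2 + p′ * 2 + 2 * (1 + p′ * 1) ≡ 2 * (2 * suc p′)
    arith = solve-∀

  cV3p-r≡2[3]-r≡1[p]-p∤t : r % 3 ≡ 2 → r % p ≡ 1 % p → ¬ p ∣ t → cV3p p r t ≡ 2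
  cV3p-r≡2[3]-r≡1[p]-p∤t r≡2[3] r≡1[p] p∤t = *-cancelˡ-≡ _ _ (2 * p) {{m*n≢0 2 p}} (begin
    2 * p * cV3p p r t                       ≡⟨ cV3p-twoPeriods (affine₃ r≡2[3]) H W (2 * p) {{m*n≢0 2 p}} weights ⟩
    2 + (p ∸ 1) * 2 + 2 * (1 + (p ∸ 1) * 1)  ≡⟨ arith (p ∸ 1) ⟩
    2 * suc (p ∸ 1) * 2                      ≡⟨ cong (λ p → 2 * p * 2) (suc-pred p) ⟩
    2 * p * 2                                ∎)
    where
    open ≡-Reasoning
    H = uniformₚ (Modp.translation-periods-∤ p-prime r≡1[p] p∤t)
    W : Bool → Bool → ℕ
    W a _ = if a then 2 else 1
    weights : ∀ a b → W a b * lcm (if a then 1 else 2) p ≡ 2 * p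
    weights true  _ = cong (2 *_) (lcm[1,n]≡n p)
    weights false _ = trans (*-identityˡ _) (coprime⇒lcm[m,n]≡m*n (prime∤⇒coprime prime[2] 2∤p))
    arith : ∀ p′ → 2 + p′ * 2 + 2 * (1 + p′ * 1) ≡ 2 * suc p′ * 2
    arith = solve-∀

  cV3p-r≡2[3]-r≡1[p] : r % 3 ≡ 2 → r % p ≡ 1 % p → cV3p p r t ≡ 2 * gcd p t
  cV3p-r≡2[3]-r≡1[p] r≡2[3] r≡1[p] with p ∣? t
  ... | yes p∣t = trans (cV3p-r≡2[3]-r≡1[p]-p∣t r≡2[3] r≡1[p] p∣t) (cong (2 *_) (sym (m∣n⇒gcd[m,n]≡m p∣t)))
  ... | no  p∤t = trans (cV3p-r≡2[3]-r≡1[p]-p∤t r≡2[3] r≡1[p] p∤t)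
                        (cong (2 *_) (sym (coprime⇒gcd≡1 (prime∤⇒coprime p-prime p∤t))))

  module _ {k : ℕ} .{{_ : NonZero k}} where

    cV3p-r≡1[3]-3∣t : r % 3 ≡ 1 → ¬ r % p ≡ 1 % p → 3 ∣ t → IsMultOrder p r k →
                      cV3p p r t ≡ 3 + (3 * (p ∸ 1)) / k
    cV3p-r≡1[3]-3∣t r≡1[3] r≢1[p] 3∣t ord = m*x≡m*y+z⇒x≡y+z/m k (begin
      k * cV3p p r t                           ≡⟨ cV3p-twoPeriods G (affineₚ r≢1[p] ord) W k weights ⟩
      k + (p ∸ 1) * 1 + 2 * (k + (p ∸ 1) * 1)  ≡⟨ arith k (p ∸ 1) ⟩
      k * 3 + 3 * (p ∸ 1)                      ∎)
      where
      open ≡-Reasoning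
      G = uniform₃ (Mod3.translation-periods-∣ r≡1[3] 3∣t)
      W : Bool → Bool → ℕ
      W _ b = if b then k else 1
      weights : ∀ a b → W a b * lcm 1 (if b then 1 else k) ≡ k
      weights _ true  = trans (cong (k *_) (lcm[1,n]≡n 1)) (*-identityʳ k)
      weights _ false = trans (*-identityˡ _) (lcm[1,n]≡n k)
      arith : ∀ k p′ → k + p′ * 1 + 2 * (k + p′ * 1) ≡ k * 3 + 3 * p′
      arith = solve-∀

    cV3p-r≡1[3]-3∤t-3∤k : r % 3 ≡ 1 → ¬ r % p ≡ 1 % p → ¬ 3 ∣ t → ¬ 3 ∣ k → IsMultOrder p r k →
                          cV3p p r t ≡ 1 + (p ∸ 1) / k
    cV3p-r≡1[3]-3∤t-3∤k r≡1[3] r≢1[p] 3∤t 3∤k ord = m*x≡m*y+z⇒x≡y+z/m k (*-cancelˡ-≡ _ _ 3 (begin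
      3 * (k * cV3p p r t)                     ≡⟨ *-assoc 3 k _ ⟨
      3 * k * cV3p p r t
        ≡⟨ cV3p-twoPeriods G (affineₚ r≢1[p] ord) W (3 * k) {{m*n≢0 3 k}} weights ⟩
      k + (p ∸ 1) * 1 + 2 * (k + (p ∸ 1) * 1)  ≡⟨ arith k (p ∸ 1) ⟩
      3 * (k * 1 + (p ∸ 1))                    ∎))
      where
      open ≡-Reasoning
      G = uniform₃ (Mod3.translation-periods-∤ prime[3] r≡1[3] 3∤t)
      W : Bool → Bool → ℕ
      W _ b = if b then k else 1
      weights : ∀ a b → W a b * lcm 3 (if b then 1 else k) ≡ 3 * k
      weights _ true  = trans (cong (k *_) (lcm[n,1]≡n 3)) (*-comm k 3)
      weights _ false = trans (*-identityˡ _) (coprime⇒lcm[m,n]≡m*n (prime∤⇒coprime prime[3] 3∤k))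
      arith : ∀ k p′ → k + p′ * 1 + 2 * (k + p′ * 1) ≡ 3 * (k * 1 + p′)
      arith = solve-∀

    cV3p-r≡1[3]-3∤t-3∣k : r % 3 ≡ 1 → ¬ r % p ≡ 1 % p → ¬ 3 ∣ t → 3 ∣ k → IsMultOrder p r k →
                          cV3p p r t ≡ 1 + (3 * (p ∸ 1)) / k
    cV3p-r≡1[3]-3∤t-3∣k r≡1[3] r≢1[p] 3∤t 3∣k@(divides k′ k≡k′*3) ord = m*x≡m*y+z⇒x≡y+z/m k (begin
      k * cV3p p r t                             ≡⟨ cV3p-twoPeriods G (affineₚ r≢1[p] ord) W k weights ⟩
      k′ + (p ∸ 1) * 1 + 2 * (k′ + (p ∸ 1) * 1)  ≡⟨ arith k′ (p ∸ 1) ⟩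
      k′ * 3 * 1 + 3 * (p ∸ 1)                   ≡⟨ cong (λ k → k * 1 + 3 * (p ∸ 1)) k≡k′*3 ⟨
      k * 1 + 3 * (p ∸ 1)                        ∎)
      where
      open ≡-Reasoning
      G = uniform₃ (Mod3.translation-periods-∤ prime[3] r≡1[3] 3∤t)
      W : Bool → Bool → ℕ
      W _ b = if b then k′ else 1
      weights : ∀ a b → W a b * lcm 3 (if b then 1 else k) ≡ k
      weights _ true  = trans (cong (k′ *_) (lcm[n,1]≡n 3)) (sym k≡k′*3)
      weights _ false = trans (*-identityˡ _) (m∣n⇒lcm[m,n]≡n 3∣k)
      arith : ∀ k′ p′ → k′ + p′ * 1 + 2 * (k′ + p′ * 1) ≡ k′ * 3 * 1 + 3 * p′
      arith = solve-∀

    cV3p-r≡2[3]-k-odd : r % 3 ≡ 2 → ¬ r % p ≡ 1 % p → IsMultOrder p r k → k % 2 ≡ 1 →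
                        cV3p p r t ≡ 2 + (2 * (p ∸ 1)) / k
    cV3p-r≡2[3]-k-odd r≡2[3] r≢1[p] ord k-odd = m*x≡m*y+z⇒x≡y+z/m k (*-cancelˡ-≡ _ _ 2 (begin
      2 * (k * cV3p p r t)                         ≡⟨ *-assoc 2 k _ ⟨
      2 * k * cV3p p r t
        ≡⟨ cV3p-twoPeriods (affine₃ r≡2[3]) (affineₚ r≢1[p] ord) W (2 * k) {{m*n≢0 2 k}} weights ⟩
      2 * k + (p ∸ 1) * 2 + 2 * (k + (p ∸ 1) * 1)  ≡⟨ arith k (p ∸ 1) ⟩
      2 * (k * 2 + 2 * (p ∸ 1))                    ∎))
      where
      open ≡-Reasoning
      2∤k : ¬ 2 ∣ k
      2∤k 2∣k with trans (sym k-odd) (n∣m⇒m%n≡0 k 2 2∣k)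
      ... | ()
      W : Bool → Bool → ℕ
      W true  true  = 2 * k
      W true  false = 2
      W false true  = k
      W false false = 1
      weights : ∀ a b → W a b * lcm (if a then 1 else 2) (if b then 1 else k) ≡ 2 * k
      weights true  true  = trans (cong (2 * k *_) (lcm[1,n]≡n 1)) (*-identityʳ (2 * k))
      weights true  false = cong (2 *_) (lcm[1,n]≡n k)
      weights false true  = trans (cong (k *_) (lcm[n,1]≡n 2)) (*-comm k 2)
      weights false false = trans (*-identityˡ _) (coprime⇒lcm[m,n]≡m*n (prime∤⇒coprime prime[2] 2∤k))
      arith : ∀ k p′ → 2 * k + p′ * 2 + 2 * (k + p′ * 1) ≡ 2 * (k * 2 + 2 * p′)
      arith = solve-∀

    cV3p-r≡2[3]-k-even : r % 3 ≡ 2 → ¬ r % p ≡ 1 % p → IsMultOrder p r k → k % 2 ≡ 0 →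
                         cV3p p r t ≡ 2 + (3 * (p ∸ 1)) / k
    cV3p-r≡2[3]-k-even r≡2[3] r≢1[p] ord k-even with m%n≡0⇒n∣m k 2 k-even
    ... | 2∣k@(divides k′ k≡k′*2) = m*x≡m*y+z⇒x≡y+z/m k (begin
      k * cV3p p r t                            ≡⟨ cV3p-twoPeriods (affine₃ r≡2[3]) (affineₚ r≢1[p] ord) W k weights ⟩
      k + (p ∸ 1) * 1 + 2 * (k′ + (p ∸ 1) * 1)  ≡⟨ arith k k′ (p ∸ 1) ⟩
      k + k′ * 2 + 3 * (p ∸ 1)                  ≡⟨ cong (λ x → k + x + 3 * (p ∸ 1)) k≡k′*2 ⟨
      k + k + 3 * (p ∸ 1)                       ≡⟨ cong (_+ 3 * (p ∸ 1)) (k+k≡k*2 k) ⟩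
      k * 2 + 3 * (p ∸ 1)                       ∎)
      where
      open ≡-Reasoning
      W : Bool → Bool → ℕ
      W true  true  = k
      W true  false = 1
      W false true  = k′
      W false false = 1
      weights : ∀ a b → W a b * lcm (if a then 1 else 2) (if b then 1 else k) ≡ k
      weights true  true  = trans (cong (k *_) (lcm[1,n]≡n 1)) (*-identityʳ k)
      weights true  false = trans (*-identityˡ _) (lcm[1,n]≡n k)
      weights false true  = trans (cong (k′ *_) (lcm[n,1]≡n 2)) (sym k≡k′*2)
      weights false false = trans (*-identityˡ _) (m∣n⇒lcm[m,n]≡n 2∣k)
      arith : ∀ k k′ p′ → k + p′ * 1 + 2 * (k′ + p′ * 1) ≡ k + k′ * 2 + 3 * p′
      arith = solve-∀
      k+k≡k*2 : ∀ k → k + k ≡ k * 2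
      k+k≡k*2 = solve-∀

lemma5p10 : (p : ℕ) .{{_ : NonZero p}} → Prime p → 3 < p →
    (t : ℕ) → (t ≡ 1 ⊎ t ≡ 3 ⊎ t ≡ p ⊎ t ≡ 3 * p) →
    (r : ℕ) → 1 ≤ r → r ≤ 3 * p ∸ 1 → gcd r (3 * p) ≡ 1 →
    (k : ℕ) .{{_ : NonZero k}} → IsMultOrder p r k →
    let c = cV3p p r t in
    (r ≡ 1 → c ≡ gcd (3 * p) t)
    × (¬ r ≡ 1 → r % 3 ≡ 1 → (t ≡ 3 ⊎ t ≡ 3 * p) → c ≡ 3 + (3 * (p ∸ 1)) / k)
    × (¬ r ≡ 1 → r % 3 ≡ 1 → (t ≡ 1 ⊎ t ≡ p) → ¬ (3 ∣ k) → c ≡ 1 + (p ∸ 1) / k)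
    × (¬ r ≡ 1 → r % 3 ≡ 1 → (t ≡ 1 ⊎ t ≡ p) → 3 ∣ k → c ≡ 1 + (3 * (p ∸ 1)) / k)
    × (r % 3 ≡ 2 → r % p ≡ 1 → c ≡ 2 * gcd p t)
    × (r % 3 ≡ 2 → ¬ r % p ≡ 1 → k % 2 ≡ 1 → c ≡ 2 + (2 * (p ∸ 1)) / k)
    × (r % 3 ≡ 2 → ¬ r % p ≡ 1 → k % 2 ≡ 0 → c ≡ 2 + (3 * (p ∸ 1)) / k)
lemma5p10 p p-prime p>3 t t∈ r r≥1 r≤3p∸1 _ k ord =
    (λ r≡1 → cV3p-r≡1 r≡1 t∈)
  , (λ r≢1 r≡1[3] t∈ → cV3p-r≡1[3]-3∣t r≡1[3] (r≢1[p] r≢1 r≡1[3]) (3∣t t∈) ord)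
  , (λ r≢1 r≡1[3] t∈ 3∤k → cV3p-r≡1[3]-3∤t-3∤k r≡1[3] (r≢1[p] r≢1 r≡1[3]) (3∤t t∈) 3∤k ord)
  , (λ r≢1 r≡1[3] t∈ 3∣k → cV3p-r≡1[3]-3∤t-3∣k r≡1[3] (r≢1[p] r≢1 r≡1[3]) (3∤t t∈) 3∣k ord)
  , (λ r≡2[3] r≡1[p] → cV3p-r≡2[3]-r≡1[p] r≡2[3] (trans r≡1[p] (sym 1%p≡1)))
  , (λ r≡2[3] r≢1[p] → cV3p-r≡2[3]-k-odd r≡2[3] (r≢1[p] ∘ flip trans 1%p≡1) ord)
  , (λ r≡2[3] r≢1[p] → cV3p-r≡2[3]-k-even r≡2[3] (r≢1[p] ∘ flip trans 1%p≡1) ord)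
  where
  instance
    r≢0 : NonZero r
    r≢0 = >-nonZero r≥1
  open Affine3p p p-prime p>3 r t
  r≢1[p] : r ≢ 1 → r % 3 ≡ 1 → ¬ r % p ≡ 1 % p
  r≢1[p] = r≢1⇒r≢1[p] (subst (suc r ≤_) (suc-pred (3 * p)) (s≤s r≤3p∸1))
  3∣t : t ≡ 3 ⊎ t ≡ 3 * p → 3 ∣ t
  3∣t (inj₁ refl) = ∣-refl
  3∣t (inj₂ refl) = m∣m*n p
  3∤t : t ≡ 1 ⊎ t ≡ p → ¬ 3 ∣ t
  3∤t (inj₁ refl) = 3∤1
  3∤t (inj₂ refl) = 3∤p
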